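{- If $n$ is a positive integer, then \[ \sum_{k = 1}^n \sum_{j = 0}^{k - 1} ( - 1)^{n - j} \frac{\left( n - j - 1 \right)!}{n - j + 1}\left\{ n \atop n - j \right\} = B_n . \]
   Context: $\left\{ n \atop m\right\}$ denotes the Stirling number of the second kind (number of partitions of an $n$-element set into $m$ nonempty blocks). $B_n$ are the Bernoulli numbers defined by $\frac{t}{e^t-1}=\sum_{n\ge0}B_n\frac{t^n}{n!}$, so $B_1=-\tfrac12$. -}

module Defs where

open import Data.Nat as ℕ using (ℕ; zero; suc; _∸_; _!)
open import Data.Nat.Combinatorics using (_C_)
open import Data.Integer as ℤ using (ℤ; +_)
open import Data.Rational as ℚ using (ℚ; _/_; 0ℚ; 1ℚ)
open import Data.List using (List; []; _∷_; _++_; [_]; length; zipWith; foldr; upTo)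

stirling2 : ℕ → ℕ → ℕ
stirling2 zero    zero    = 1
stirling2 zero    (suc m) = 0
stirling2 (suc n) zero    = 0
stirling2 (suc n) (suc m) = suc m ℕ.* stirling2 n (suc m) ℕ.+ stirling2 n m

sumℚ : ℕ → (ℕ → ℚ) → ℚ
sumℚ zero    f = 0ℚ
sumℚ (suc n) f = sumℚ n f ℚ.+ f n

-- Bernoulli numbers with B_1 = -1/2 (generating function t/(e^t-1)),
-- characterised by B_0 = 1 and  Σ_{k=0}^{m} C(m+1,k) B_k = 0  for m ≥ 1,
-- i.e.  B_m = -(1/(m+1)) Σ_{k=0}^{m-1} C(m+1,k) B_k.
-- bernoulliList m = [B_0, ..., B_m]
bernoulliList : ℕ → List ℚ
bernoulliList zero    = 1ℚ ∷ []
bernoulliList (suc m) = prev ++ [ ℚ.- (s ℚ.* (+ 1 / suc (suc m))) ]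
  where
  prev : List ℚ
  prev = bernoulliList m
  s : ℚ
  s = foldr ℚ._+_ 0ℚ
        (zipWith (λ k b → ((+ (suc (suc m) C k)) / 1) ℚ.* b) (upTo (suc m)) prev)

last : ℚ → List ℚ → ℚ
last d []       = d
last d (x ∷ xs) = last x xs

bernoulli : ℕ → ℚ
bernoulli m = last 0ℚ (bernoulliList m)

sign : ℕ → ℚ
sign zero    = 1ℚ
sign (suc k) = ℚ.- sign k

{-# OPTIONS --safe #-}
-- Counting how often each summand occurs, the double sum equals
-- Σ_{m=1}^{n} (-1)^m m!/(m+1) S(n,m), the classical Stirling-number formula for B_n.
-- This expression satisfies the recurrence Σ_{k<N} C(N,k) B_k = 0 (N ≥ 2) defining the
-- Bernoulli numbers: exchanging the sums and using Σ_{k<N} C(N,k) S(k,j) = (j+1) S(N,j+1)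
-- reduces it to Σ_j (-1)^j j! S(N,j+1) = 0, which telescopes by the recurrence for S.
module Submission where

open import Defs
open import Data.Nat using (ℕ; suc; _∸_; _!; NonZero)
open import Data.Integer using (+_)
open import Data.Rational using (ℚ; _/_; _*_)
open import Relation.Binary.PropositionalEquality using (_≡_)

open import Data.Nat as ℕ using (zero; _≤′_; ≤′-refl; ≤′-step)
import Data.Nat.Properties as ℕP
open import Data.Nat.Combinatorics using (_C_; nCn≡1; nC1≡n; nCk≡nC[n∸k]; nCk+nC[k+1]≡[n+1]C[k+1]; k>n⇒nCk≡0)
import Data.Integer as ℤ
import Data.Integer.Properties as ℤP
open import Data.Rational using (0ℚ; 1ℚ; _+_; -_; _-_; fromℚᵘ)
open import Data.Rational.Properties using (toℚᵘ-injective; toℚᵘ-homo-+; toℚᵘ-homo-*; toℚᵘ-fromℚᵘ; fromℚᵘ-cong; +-identityˡ; +-0-group)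
import Data.Rational.Unnormalised as ℚᵘ
import Data.Rational.Unnormalised.Properties as ℚᵘP
open import Algebra.Properties.Group +-0-group using (∙-cancelʳ)
open import Data.Rational.Solver using (module +-*-Solver)
open import Data.List using (List; []; _∷_; _++_; [_]; zipWith; foldr; applyUpTo; upTo)
open import Data.List.Properties using (applyUpTo-∷ʳ)
open import Function using (id; _∘_)
open import Relation.Binary.PropositionalEquality using (refl; sym; trans; cong; cong₂; module ≡-Reasoning)

open +-*-Solver
open ≡-Reasoning

ι : ℕ → ℚ
ι n = + n / 1

fromℚᵘ-homo-+ : ∀ p q → fromℚᵘ (p ℚᵘ.+ q) ≡ fromℚᵘ p + fromℚᵘ q
fromℚᵘ-homo-+ p q = toℚᵘ-injective (ℚᵘP.≃-trans (toℚᵘ-fromℚᵘ (p ℚᵘ.+ q))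
  (ℚᵘP.≃-trans (ℚᵘP.+-cong (ℚᵘP.≃-sym (toℚᵘ-fromℚᵘ p)) (ℚᵘP.≃-sym (toℚᵘ-fromℚᵘ q)))
               (ℚᵘP.≃-sym (toℚᵘ-homo-+ (fromℚᵘ p) (fromℚᵘ q)))))

fromℚᵘ-homo-* : ∀ p q → fromℚᵘ (p ℚᵘ.* q) ≡ fromℚᵘ p * fromℚᵘ q
fromℚᵘ-homo-* p q = toℚᵘ-injective (ℚᵘP.≃-trans (toℚᵘ-fromℚᵘ (p ℚᵘ.* q))
  (ℚᵘP.≃-trans (ℚᵘP.*-cong (ℚᵘP.≃-sym (toℚᵘ-fromℚᵘ p)) (ℚᵘP.≃-sym (toℚᵘ-fromℚᵘ q)))
               (ℚᵘP.≃-sym (toℚᵘ-homo-* (fromℚᵘ p) (fromℚᵘ q)))))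

ι-homo-+ : ∀ a b → ι (a ℕ.+ b) ≡ ι a + ι b
ι-homo-+ a b =
  trans (fromℚᵘ-cong {ℚᵘ.mkℚᵘ (+ (a ℕ.+ b)) 0} {â ℚᵘ.+ b̂} (ℚᵘ.*≡* eq)) (fromℚᵘ-homo-+ â b̂)
  where
  â b̂ : ℚᵘ.ℚᵘ
  â = ℚᵘ.mkℚᵘ (+ a) 0
  b̂ = ℚᵘ.mkℚᵘ (+ b) 0
  eq : + (a ℕ.+ b) ℤ.* + 1 ≡ (+ a ℤ.* + 1 ℤ.+ + b ℤ.* + 1) ℤ.* + 1
  eq = cong (ℤ._* + 1) (trans (ℤP.pos-+ a b)
         (sym (cong₂ ℤ._+_ (ℤP.*-identityʳ (+ a)) (ℤP.*-identityʳ (+ b)))))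

ι-homo-* : ∀ a b → ι (a ℕ.* b) ≡ ι a * ι b
ι-homo-* a b =
  trans (fromℚᵘ-cong {ℚᵘ.mkℚᵘ (+ (a ℕ.* b)) 0} {â ℚᵘ.* b̂} (ℚᵘ.*≡* eq)) (fromℚᵘ-homo-* â b̂)
  where
  â b̂ : ℚᵘ.ℚᵘ
  â = ℚᵘ.mkℚᵘ (+ a) 0
  b̂ = ℚᵘ.mkℚᵘ (+ b) 0
  eq : + (a ℕ.* b) ℤ.* + 1 ≡ (+ a ℤ.* + b) ℤ.* + 1
  eq = cong (ℤ._* + 1) (ℤP.pos-* a b)

ι[k]*[a/d]≡[k*a]/d : ∀ k a d → ι k * (+ a / suc d) ≡ + (k ℕ.* a) / suc d
ι[k]*[a/d]≡[k*a]/d k a d =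
  trans (sym (fromℚᵘ-homo-* k̂ â)) (fromℚᵘ-cong {k̂ ℚᵘ.* â} {ℚᵘ.mkℚᵘ (+ (k ℕ.* a)) d} (ℚᵘ.*≡* eq))
  where
  k̂ â : ℚᵘ.ℚᵘ
  k̂ = ℚᵘ.mkℚᵘ (+ k) 0
  â = ℚᵘ.mkℚᵘ (+ a) d
  eq : (+ k ℤ.* + a) ℤ.* + suc d ≡ + (k ℕ.* a) ℤ.* + suc (d ℕ.+ 0)
  eq = cong₂ ℤ._*_ (sym (ℤP.pos-* k a)) (cong (λ x → + suc x) (sym (ℕP.+-identityʳ d)))

[a/d]*ι[d]≡ι[a] : ∀ a d → (+ a / suc d) * ι (suc d) ≡ ι a
[a/d]*ι[d]≡ι[a] a d =
  trans (sym (fromℚᵘ-homo-* â d̂)) (fromℚᵘ-cong {â ℚᵘ.* d̂} {ℚᵘ.mkℚᵘ (+ a) 0} (ℚᵘ.*≡* eq))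
  where
  â d̂ : ℚᵘ.ℚᵘ
  â = ℚᵘ.mkℚᵘ (+ a) d
  d̂ = ℚᵘ.mkℚᵘ (+ suc d) 0
  eq : (+ a ℤ.* + suc d) ℤ.* + 1 ≡ + a ℤ.* + suc (d ℕ.* 1)
  eq = trans (ℤP.*-identityʳ _) (cong (λ x → + a ℤ.* + suc x) (sym (ℕP.*-identityʳ d)))

sumℚ-cong : ∀ n {f g : ℕ → ℚ} → (∀ i → i ℕ.< n → f i ≡ g i) → sumℚ n f ≡ sumℚ n g
sumℚ-cong zero    f≡g = refl
sumℚ-cong (suc n) f≡g = cong₂ _+_ (sumℚ-cong n (λ i i<n → f≡g i (ℕP.m<n⇒m<1+n i<n))) (f≡g n (ℕP.n<1+n n))

sumℚ-zero : ∀ n → sumℚ n (λ _ → 0ℚ) ≡ 0ℚ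
sumℚ-zero zero    = refl
sumℚ-zero (suc n) = cong (_+ 0ℚ) (sumℚ-zero n)

sumℚ-distrib-+ : ∀ n (f g : ℕ → ℚ) → sumℚ n (λ i → f i + g i) ≡ sumℚ n f + sumℚ n g
sumℚ-distrib-+ zero    f g = refl
sumℚ-distrib-+ (suc n) f g = trans (cong (_+ (f n + g n)) (sumℚ-distrib-+ n f g))
  (solve 4 (λ a b c d → (a :+ b) :+ (c :+ d) := (a :+ c) :+ (b :+ d)) refl (sumℚ n f) (sumℚ n g) (f n) (g n))

sumℚ-distribˡ-* : ∀ n c (f : ℕ → ℚ) → sumℚ n (λ i → c * f i) ≡ c * sumℚ n f
sumℚ-distribˡ-* zero    c f = solve 1 (λ c → con 0ℚ := c :* con 0ℚ) refl c
sumℚ-distribˡ-* (suc n) c f = trans (cong (_+ (c * f n)) (sumℚ-distribˡ-* n c f))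
  (solve 3 (λ c a b → c :* a :+ c :* b := c :* (a :+ b)) refl c (sumℚ n f) (f n))

sumℚ-head : ∀ n (f : ℕ → ℚ) → sumℚ (suc n) f ≡ f 0 + sumℚ n (f ∘ suc)
sumℚ-head zero    f = solve 1 (λ a → con 0ℚ :+ a := a :+ con 0ℚ) refl (f 0)
sumℚ-head (suc n) f = trans (cong (_+ f (suc n)) (sumℚ-head n f))
  (solve 3 (λ a b c → (a :+ b) :+ c := a :+ (b :+ c)) refl (f 0) (sumℚ n (f ∘ suc)) (f (suc n)))

sumℚ-comm : ∀ m n (f : ℕ → ℕ → ℚ) →
  sumℚ m (λ i → sumℚ n (f i)) ≡ sumℚ n (λ j → sumℚ m (λ i → f i j))
sumℚ-comm zero    n f = sym (sumℚ-zero n)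
sumℚ-comm (suc m) n f = trans (cong (_+ sumℚ n (f m)) (sumℚ-comm m n f))
  (sym (sumℚ-distrib-+ n (λ j → sumℚ m (λ i → f i j)) (f m)))

sumℚ-extend : ∀ {m n} (f : ℕ → ℚ) → m ℕ.≤ n → (∀ i → m ℕ.≤ i → f i ≡ 0ℚ) → sumℚ n f ≡ sumℚ m f
sumℚ-extend {m} f m≤n vanish = go (ℕP.≤⇒≤′ m≤n)
  where
  go : ∀ {n} → m ≤′ n → sumℚ n f ≡ sumℚ m f
  go ≤′-refl = refl
  go {suc n} (≤′-step m≤′n) = trans (cong₂ _+_ (go m≤′n) (vanish n (ℕP.≤′⇒≤ m≤′n)))
    (solve 1 (λ a → a :+ con 0ℚ := a) refl (sumℚ m f))

sumℚ-telescope : ∀ n (f : ℕ → ℚ) → sumℚ n (λ j → f j - f (suc j)) ≡ f 0 - f n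
sumℚ-telescope zero    f = solve 1 (λ a → con 0ℚ := a :- a) refl (f 0)
sumℚ-telescope (suc n) f = trans (cong (_+ (f n - f (suc n))) (sumℚ-telescope n f))
  (solve 3 (λ a b c → (a :- b) :+ (b :- c) := a :- c) refl (f 0) (f n) (f (suc n)))

sumℚ-reverse : ∀ n (f : ℕ → ℚ) → sumℚ n f ≡ sumℚ n (λ i → f (n ∸ suc i))
sumℚ-reverse zero    f = refl
sumℚ-reverse (suc n) f = trans (cong (_+ f n) (sumℚ-reverse n f))
  (trans (solve 2 (λ a b → a :+ b := b :+ a) refl (sumℚ n (λ i → f (n ∸ suc i))) (f n))
         (sym (sumℚ-head n (λ i → f (suc n ∸ suc i)))))

sumℚ-triangle : ∀ n (f : ℕ → ℚ) → sumℚ n (λ k → sumℚ (suc k) f) ≡ sumℚ n (λ j → ι (n ∸ j) * f j)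
sumℚ-triangle zero    f = refl
sumℚ-triangle (suc n) f = begin
  sumℚ n (λ k → sumℚ (suc k) f) + sumℚ (suc n) f
    ≡⟨ cong (_+ sumℚ (suc n) f) (trans (sumℚ-triangle n f)
                                       (sym (sumℚ-extend g (ℕP.n≤1+n n) g-vanish))) ⟩
  sumℚ (suc n) g + sumℚ (suc n) f
    ≡⟨ sym (sumℚ-distrib-+ (suc n) g f) ⟩
  sumℚ (suc n) (λ j → g j + f j)
    ≡⟨ sumℚ-cong (suc n) (λ j j<1+n → sym (count-suc j (ℕP.≤-pred j<1+n))) ⟩
  sumℚ (suc n) (λ j → ι (suc n ∸ j) * f j) ∎
  where
  g : ℕ → ℚ
  g j = ι (n ∸ j) * f j
  g-vanish : ∀ j → n ℕ.≤ j → g j ≡ 0ℚ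
  g-vanish j n≤j = trans (cong (λ x → ι x * f j) (ℕP.m≤n⇒m∸n≡0 n≤j))
    (solve 1 (λ a → con 0ℚ :* a := con 0ℚ) refl (f j))
  count-suc : ∀ j → j ℕ.≤ n → ι (suc n ∸ j) * f j ≡ g j + f j
  count-suc j j≤n = trans (cong (λ x → ι x * f j) (ℕP.+-∸-assoc 1 j≤n))
    (trans (cong (_* f j) (ι-homo-+ 1 (n ∸ j)))
           (solve 2 (λ a b → (con 1ℚ :+ a) :* b := a :* b :+ b) refl (ι (n ∸ j)) (f j)))

sumℚ-triangle-reverse : ∀ n (f : ℕ → ℚ) →
  sumℚ n (λ k → sumℚ (suc k) (λ j → f (n ∸ j))) ≡ sumℚ n (λ i → ι (suc i) * f (suc i))
sumℚ-triangle-reverse n f = begin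
  sumℚ n (λ k → sumℚ (suc k) (λ j → f (n ∸ j)))
    ≡⟨ sumℚ-triangle n (λ j → f (n ∸ j)) ⟩
  sumℚ n (λ j → ι (n ∸ j) * f (n ∸ j))
    ≡⟨ sumℚ-reverse n _ ⟩
  sumℚ n (λ i → ι (n ∸ (n ∸ suc i)) * f (n ∸ (n ∸ suc i)))
    ≡⟨ sumℚ-cong n (λ i i<n → cong (λ m → ι m * f m) (ℕP.m∸[m∸n]≡n i<n)) ⟩
  sumℚ n (λ i → ι (suc i) * f (suc i)) ∎

binomialSum : ℕ → (ℕ → ℚ) → ℚ
binomialSum n f = sumℚ (suc n) (λ k → ι (n C k) * f k)

binomialSum-suc : ∀ n (f : ℕ → ℚ) → binomialSum (suc n) f ≡ binomialSum n f + binomialSum n (f ∘ suc)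
binomialSum-suc n f = begin
  binomialSum (suc n) f
    ≡⟨ sumℚ-head (suc n) _ ⟩
  1ℚ * f 0 + sumℚ (suc n) (λ k → ι (suc n C suc k) * f (suc k))
    ≡⟨ cong (_+_ (1ℚ * f 0)) (trans (sumℚ-cong (suc n) (λ k _ → pascal k))
                                    (sumℚ-distrib-+ (suc n) _ tail)) ⟩
  1ℚ * f 0 + (binomialSum n (f ∘ suc) + sumℚ (suc n) tail)
    ≡⟨ cong (λ x → 1ℚ * f 0 + (binomialSum n (f ∘ suc) + x))
            (sumℚ-extend tail (ℕP.n≤1+n n) tail-vanish) ⟩
  1ℚ * f 0 + (binomialSum n (f ∘ suc) + sumℚ n tail)
    ≡⟨ solve 3 (λ a b c → a :+ (b :+ c) := (a :+ c) :+ b) refl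
         (1ℚ * f 0) (binomialSum n (f ∘ suc)) (sumℚ n tail) ⟩
  (1ℚ * f 0 + sumℚ n tail) + binomialSum n (f ∘ suc)
    ≡⟨ cong (_+ binomialSum n (f ∘ suc)) (sym (sumℚ-head n _)) ⟩
  binomialSum n f + binomialSum n (f ∘ suc) ∎
  where
  tail : ℕ → ℚ
  tail k = ι (n C suc k) * f (suc k)
  tail-vanish : ∀ k → n ℕ.≤ k → tail k ≡ 0ℚ
  tail-vanish k n≤k = trans (cong (λ c → ι c * f (suc k)) (k>n⇒nCk≡0 (ℕ.s≤s n≤k)))
    (solve 1 (λ a → con 0ℚ :* a := con 0ℚ) refl (f (suc k)))
  pascal : ∀ k → ι (suc n C suc k) * f (suc k) ≡ ι (n C k) * f (suc k) + tail k
  pascal k = trans (cong (λ c → ι c * f (suc k)) (sym (nCk+nC[k+1]≡[n+1]C[k+1] n k)))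
    (trans (cong (_* f (suc k)) (ι-homo-+ (n C k) (n C suc k)))
           (solve 3 (λ a b x → (a :+ b) :* x := a :* x :+ b :* x) refl (ι (n C k)) (ι (n C suc k)) (f (suc k))))

binomialSum-linear : ∀ n c (f g : ℕ → ℚ) →
  binomialSum n (λ k → c * f k + g k) ≡ c * binomialSum n f + binomialSum n g
binomialSum-linear n c f g = begin
  binomialSum n (λ k → c * f k + g k)
    ≡⟨ sumℚ-cong (suc n) (λ k _ → solve 4 (λ b c x y → b :* (c :* x :+ y) := c :* (b :* x) :+ b :* y) refl
                                     (ι (n C k)) c (f k) (g k)) ⟩
  sumℚ (suc n) (λ k → c * (ι (n C k) * f k) + ι (n C k) * g k)
    ≡⟨ sumℚ-distrib-+ (suc n) _ _ ⟩
  sumℚ (suc n) (λ k → c * (ι (n C k) * f k)) + binomialSum n g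
    ≡⟨ cong (_+ binomialSum n g) (sumℚ-distribˡ-* (suc n) c _) ⟩
  c * binomialSum n f + binomialSum n g ∎

S : ℕ → ℕ → ℚ
S n m = ι (stirling2 n m)

n<m⇒stirling2≡0 : ∀ {n m} → n ℕ.< m → stirling2 n m ≡ 0
n<m⇒stirling2≡0 {zero}  {suc m} _ = refl
n<m⇒stirling2≡0 {suc n} {suc m} (ℕ.s≤s n<m)
  rewrite n<m⇒stirling2≡0 (ℕP.m<n⇒m<1+n n<m) | n<m⇒stirling2≡0 n<m
  = trans (ℕP.+-identityʳ _) (ℕP.*-zeroʳ (suc m))

S-suc : ∀ n m → S (suc n) (suc m) ≡ ι (suc m) * S n (suc m) + S n m
S-suc n m = trans (ι-homo-+ (suc m ℕ.* stirling2 n (suc m)) (stirling2 n m))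
  (cong (_+ S n m) (ι-homo-* (suc m) (stirling2 n (suc m))))

binomialSum-S : ∀ n m → binomialSum n (λ k → S k m) ≡ S (suc n) (suc m)
binomialSum-S zero m =
  trans (solve 2 (λ x c → con 0ℚ :+ con 1ℚ :* x := c :* con 0ℚ :+ x) refl (S 0 m) (ι (suc m))) (sym (S-suc 0 m))
binomialSum-S (suc n) m = begin
  binomialSum (suc n) (λ k → S k m)
    ≡⟨ binomialSum-suc n _ ⟩
  binomialSum n (λ k → S k m) + binomialSum n (λ k → S (suc k) m)
    ≡⟨ cong₂ _+_ (binomialSum-S n m) (shifted m) ⟩
  S (suc n) (suc m) + (ι m * S (suc n) (suc m) + S (suc n) m)
    ≡⟨ solve 3 (λ a c b → a :+ (c :* a :+ b) := (con 1ℚ :+ c) :* a :+ b) refl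
         (S (suc n) (suc m)) (ι m) (S (suc n) m) ⟩
  (1ℚ + ι m) * S (suc n) (suc m) + S (suc n) m
    ≡⟨ cong (λ c → c * S (suc n) (suc m) + S (suc n) m) (sym (ι-homo-+ 1 m)) ⟩
  ι (suc m) * S (suc n) (suc m) + S (suc n) m
    ≡⟨ sym (S-suc (suc n) m) ⟩
  S (suc (suc n)) (suc m) ∎
  where
  shifted : ∀ j → binomialSum n (λ k → S (suc k) j) ≡ ι j * S (suc n) (suc j) + S (suc n) j
  shifted zero = trans (sumℚ-cong (suc n) (λ k _ → solve 1 (λ b → b :* con 0ℚ := con 0ℚ) refl (ι (n C k))))
    (trans (sumℚ-zero (suc n)) (solve 1 (λ x → con 0ℚ := con 0ℚ :* x :+ con 0ℚ) refl (S (suc n) 1)))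
  shifted (suc j) = begin
    binomialSum n (λ k → S (suc k) (suc j))
      ≡⟨ sumℚ-cong (suc n) (λ k _ → cong (ι (n C k) *_) (S-suc k j)) ⟩
    binomialSum n (λ k → ι (suc j) * S k (suc j) + S k j)
      ≡⟨ binomialSum-linear n (ι (suc j)) _ _ ⟩
    ι (suc j) * binomialSum n (λ k → S k (suc j)) + binomialSum n (λ k → S k j)
      ≡⟨ cong₂ (λ u v → ι (suc j) * u + v) (binomialSum-S n (suc j)) (binomialSum-S n j) ⟩
    ι (suc j) * S (suc n) (suc (suc j)) + S (suc n) (suc j) ∎

sumℚ-binomial-S : ∀ n j → sumℚ n (λ k → ι (n C k) * S k j) ≡ ι (suc j) * S n (suc j)
sumℚ-binomial-S n j = ∙-cancelʳ (S n j) _ _ (begin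
  sumℚ n (λ k → ι (n C k) * S k j) + S n j
    ≡⟨ cong (_+_ (sumℚ n (λ k → ι (n C k) * S k j))) (solve 1 (λ x → x := con 1ℚ :* x) refl (S n j)) ⟩
  sumℚ n (λ k → ι (n C k) * S k j) + 1ℚ * S n j
    ≡⟨ cong (λ c → sumℚ n (λ k → ι (n C k) * S k j) + ι c * S n j) (sym (nCn≡1 n)) ⟩
  binomialSum n (λ k → S k j)
    ≡⟨ binomialSum-S n j ⟩
  S (suc n) (suc j)
    ≡⟨ S-suc n j ⟩
  ι (suc j) * S n (suc j) + S n j ∎)

sumℚ-alternating-S≡0 : ∀ n →
  sumℚ (suc (suc n)) (λ j → sign j * (ι (j !) * S (suc (suc n)) (suc j))) ≡ 0ℚ
sumℚ-alternating-S≡0 n = begin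
  sumℚ (suc (suc n)) (λ j → sign j * (ι (j !) * S (suc (suc n)) (suc j)))
    ≡⟨ sumℚ-cong (suc (suc n)) (λ j _ → difference j) ⟩
  sumℚ (suc (suc n)) (λ j → g j - g (suc j))
    ≡⟨ sumℚ-telescope (suc (suc n)) g ⟩
  g 0 - g (suc (suc n))
    ≡⟨ cong (λ s → g 0 - sign (suc (suc n)) * (ι (suc (suc n) !) * ι s))
            (n<m⇒stirling2≡0 (ℕP.n<1+n (suc n))) ⟩
  0ℚ - sign (suc (suc n)) * (ι (suc (suc n) !) * 0ℚ)
    ≡⟨ solve 2 (λ s f → con 0ℚ :- s :* (f :* con 0ℚ) := con 0ℚ) refl
         (sign (suc (suc n))) (ι (suc (suc n) !)) ⟩
  0ℚ ∎
  where
  g : ℕ → ℚ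
  g j = sign j * (ι (j !) * S (suc n) j)
  difference : ∀ j → sign j * (ι (j !) * S (suc (suc n)) (suc j)) ≡ g j - g (suc j)
  difference j = begin
    sign j * (ι (j !) * S (suc (suc n)) (suc j))
      ≡⟨ cong (λ x → sign j * (ι (j !) * x)) (S-suc (suc n) j) ⟩
    sign j * (ι (j !) * (ι (suc j) * S (suc n) (suc j) + S (suc n) j))
      ≡⟨ solve 5 (λ s f c x y → s :* (f :* (c :* x :+ y)) := s :* (f :* y) :- (:- s) :* ((c :* f) :* x)) refl
           (sign j) (ι (j !)) (ι (suc j)) (S (suc n) (suc j)) (S (suc n) j) ⟩
    g j - sign (suc j) * ((ι (suc j) * ι (j !)) * S (suc n) (suc j))
      ≡⟨ cong (λ f → g j - sign (suc j) * (f * S (suc n) (suc j))) (sym (ι-homo-* (suc j) (j !))) ⟩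
    g j - g (suc j) ∎

stirlingTerm : ℕ → ℕ → ℚ
stirlingTerm n j = sign j * ((+ (j !) / suc j) * S n j)

stirlingBernoulli : ℕ → ℚ
stirlingBernoulli n = sumℚ (suc n) (stirlingTerm n)

stirlingBernoulli-extend : ∀ {n M} → n ℕ.< M → stirlingBernoulli n ≡ sumℚ M (stirlingTerm n)
stirlingBernoulli-extend {n} n<M = sym (sumℚ-extend (stirlingTerm n) n<M vanish)
  where
  vanish : ∀ j → suc n ℕ.≤ j → stirlingTerm n j ≡ 0ℚ
  vanish j n<j = trans (cong (λ s → sign j * ((+ (j !) / suc j) * ι s)) (n<m⇒stirling2≡0 n<j))
    (solve 2 (λ s x → s :* (x :* con 0ℚ) := con 0ℚ) refl (sign j) (+ (j !) / suc j))

stirlingBernoulli-recurrence : ∀ n →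
  sumℚ (suc (suc n)) (λ k → ι (suc (suc n) C k) * stirlingBernoulli k) ≡ 0ℚ
stirlingBernoulli-recurrence n = begin
  sumℚ M (λ k → ι (M C k) * stirlingBernoulli k)
    ≡⟨ sumℚ-cong M (λ k k<M → trans (cong (ι (M C k) *_) (stirlingBernoulli-extend k<M))
                                     (sym (sumℚ-distribˡ-* M (ι (M C k)) (stirlingTerm k)))) ⟩
  sumℚ M (λ k → sumℚ M (λ j → ι (M C k) * stirlingTerm k j))
    ≡⟨ sumℚ-comm M M _ ⟩
  sumℚ M (λ j → sumℚ M (λ k → ι (M C k) * stirlingTerm k j))
    ≡⟨ sumℚ-cong M (λ j _ → inner j) ⟩
  sumℚ M (λ j → sign j * (ι (j !) * S M (suc j)))
    ≡⟨ sumℚ-alternating-S≡0 n ⟩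
  0ℚ ∎
  where
  M : ℕ
  M = suc (suc n)
  inner : ∀ j → sumℚ M (λ k → ι (M C k) * stirlingTerm k j) ≡ sign j * (ι (j !) * S M (suc j))
  inner j = begin
    sumℚ M (λ k → ι (M C k) * stirlingTerm k j)
      ≡⟨ sumℚ-cong M (λ k _ → solve 4 (λ c s x y → c :* (s :* (x :* y)) := (s :* x) :* (c :* y)) refl
                                 (ι (M C k)) (sign j) (+ (j !) / suc j) (S k j)) ⟩
    sumℚ M (λ k → (sign j * (+ (j !) / suc j)) * (ι (M C k) * S k j))
      ≡⟨ sumℚ-distribˡ-* M (sign j * (+ (j !) / suc j)) (λ k → ι (M C k) * S k j) ⟩
    (sign j * (+ (j !) / suc j)) * sumℚ M (λ k → ι (M C k) * S k j)
      ≡⟨ cong ((sign j * (+ (j !) / suc j)) *_) (sumℚ-binomial-S M j) ⟩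
    (sign j * (+ (j !) / suc j)) * (ι (suc j) * S M (suc j))
      ≡⟨ solve 4 (λ s a c x → (s :* a) :* (c :* x) := s :* ((a :* c) :* x)) refl
           (sign j) (+ (j !) / suc j) (ι (suc j)) (S M (suc j)) ⟩
    sign j * (((+ (j !) / suc j) * ι (suc j)) * S M (suc j))
      ≡⟨ cong (λ x → sign j * (x * S M (suc j))) ([a/d]*ι[d]≡ι[a] (j !) j) ⟩
    sign j * (ι (j !) * S M (suc j)) ∎

stirlingBernoulli-suc : ∀ m →
  - (sumℚ (suc m) (λ k → ι (suc (suc m) C k) * stirlingBernoulli k) * (+ 1 / suc (suc m)))
  ≡ stirlingBernoulli (suc m)
stirlingBernoulli-suc m = begin
  - (s * d⁻¹)
    ≡⟨ solve 4 (λ s q d x → :- (s :* q) := :- ((s :+ d :* x) :* q) :+ x :* (q :* d)) refl s d⁻¹ d b ⟩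
  - ((s + d * b) * d⁻¹) + b * (d⁻¹ * d)
    ≡⟨ cong₂ (λ u v → - (u * d⁻¹) + b * v) recurrence ([a/d]*ι[d]≡ι[a] 1 (suc m)) ⟩
  - (0ℚ * d⁻¹) + b * 1ℚ
    ≡⟨ solve 2 (λ q x → :- (con 0ℚ :* q) :+ x :* con 1ℚ := x) refl d⁻¹ b ⟩
  b ∎
  where
  s d⁻¹ d b : ℚ
  s = sumℚ (suc m) (λ k → ι (suc (suc m) C k) * stirlingBernoulli k)
  d⁻¹ = + 1 / suc (suc m)
  d = ι (suc (suc m))
  b = stirlingBernoulli (suc m)
  [m+2]C[m+1]≡m+2 : suc (suc m) C suc m ≡ suc (suc m)
  [m+2]C[m+1]≡m+2 = trans (nCk≡nC[n∸k] (ℕP.n≤1+n (suc m)))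
    (trans (cong (suc (suc m) C_) (ℕP.m+n∸n≡m 1 (suc m))) (nC1≡n (suc (suc m))))
  recurrence : s + d * b ≡ 0ℚ
  recurrence = trans (cong (λ c → s + ι c * b) (sym [m+2]C[m+1]≡m+2)) (stirlingBernoulli-recurrence m)

zipWith-applyUpTo : ∀ {A B C : Set} n (f : ℕ → A) (g : ℕ → B) (h : A → B → C) →
  zipWith h (applyUpTo f n) (applyUpTo g n) ≡ applyUpTo (λ k → h (f k) (g k)) n
zipWith-applyUpTo zero    f g h = refl
zipWith-applyUpTo (suc n) f g h = cong (h (f 0) (g 0) ∷_) (zipWith-applyUpTo n (f ∘ suc) (g ∘ suc) h)

foldr-+-applyUpTo : ∀ n (f : ℕ → ℚ) → foldr _+_ 0ℚ (applyUpTo f n) ≡ sumℚ n f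
foldr-+-applyUpTo zero    f = refl
foldr-+-applyUpTo (suc n) f = trans (cong (_+_ (f 0)) (foldr-+-applyUpTo n (f ∘ suc))) (sym (sumℚ-head n f))

last-∷ʳ : ∀ d xs (x : ℚ) → last d (xs ++ [ x ]) ≡ x
last-∷ʳ d []       x = refl
last-∷ʳ d (y ∷ ys) x = last-∷ʳ y ys x

bernoulliList≡applyUpTo : ∀ m → bernoulliList m ≡ applyUpTo stirlingBernoulli (suc m)
bernoulliList≡applyUpTo zero = cong [_] (solve 0 (con 1ℚ := con 0ℚ :+ con 1ℚ :* (con 1ℚ :* con 1ℚ)) refl)
bernoulliList≡applyUpTo (suc m) rewrite bernoulliList≡applyUpTo m = begin
  bs ++ [ - (foldr _+_ 0ℚ (zipWith c (upTo (suc m)) bs) * (+ 1 / suc (suc m))) ]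
    ≡⟨ cong (λ x → bs ++ [ - (x * (+ 1 / suc (suc m))) ])
         (trans (cong (foldr _+_ 0ℚ) (zipWith-applyUpTo (suc m) id stirlingBernoulli c))
                (foldr-+-applyUpTo (suc m) _)) ⟩
  bs ++ [ - (sumℚ (suc m) (λ k → c k (stirlingBernoulli k)) * (+ 1 / suc (suc m))) ]
    ≡⟨ cong (λ x → bs ++ [ x ]) (stirlingBernoulli-suc m) ⟩
  bs ++ [ stirlingBernoulli (suc m) ]
    ≡⟨ applyUpTo-∷ʳ stirlingBernoulli (suc m) ⟩
  applyUpTo stirlingBernoulli (suc (suc m)) ∎
  where
  bs : List ℚ
  bs = applyUpTo stirlingBernoulli (suc m)
  c : ℕ → ℚ → ℚ
  c k x = ι (suc (suc m) C k) * x

bernoulli≡stirlingBernoulli : ∀ n → bernoulli n ≡ stirlingBernoulli n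
bernoulli≡stirlingBernoulli n = begin
  last 0ℚ (bernoulliList n)
    ≡⟨ cong (last 0ℚ) (trans (bernoulliList≡applyUpTo n) (sym (applyUpTo-∷ʳ stirlingBernoulli n))) ⟩
  last 0ℚ (applyUpTo stirlingBernoulli n ++ [ stirlingBernoulli n ])
    ≡⟨ last-∷ʳ 0ℚ (applyUpTo stirlingBernoulli n) (stirlingBernoulli n) ⟩
  stirlingBernoulli n ∎

proposition6 : (n : ℕ) → .{{_ : NonZero n}} →
    sumℚ n (λ k′ → sumℚ (suc k′) (λ j →
      sign (n ∸ j) * ((+ ((n ∸ j ∸ 1) !) / suc (n ∸ j)) * (+ stirling2 n (n ∸ j) / 1))))
    ≡ bernoulli n
proposition6 n@(suc _) = begin
  sumℚ n (λ k → sumℚ (suc k) (λ j → f (n ∸ j)))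
    ≡⟨ sumℚ-triangle-reverse n f ⟩
  sumℚ n (λ i → ι (suc i) * f (suc i))
    ≡⟨ sumℚ-cong n (λ i _ → absorb-weight i) ⟩
  sumℚ n (λ i → stirlingTerm n (suc i))
    -- stirlingTerm n 0 computes to 0ℚ since stirling2 (suc _) 0 = 0
    ≡⟨ sym (+-identityˡ _) ⟩
  stirlingTerm n 0 + sumℚ n (λ i → stirlingTerm n (suc i))
    ≡⟨ sym (sumℚ-head n (stirlingTerm n)) ⟩
  stirlingBernoulli n
    ≡⟨ sym (bernoulli≡stirlingBernoulli n) ⟩
  bernoulli n ∎
  where
  f : ℕ → ℚ
  f m = sign m * ((+ ((m ∸ 1) !) / suc m) * S n m)
  absorb-weight : ∀ i → ι (suc i) * f (suc i) ≡ stirlingTerm n (suc i)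
  absorb-weight i = trans
    (solve 4 (λ c s a x → c :* (s :* (a :* x)) := s :* ((c :* a) :* x)) refl
       (ι (suc i)) (sign (suc i)) (+ (i !) / suc (suc i)) (S n (suc i)))
    (cong (λ x → sign (suc i) * (x * S n (suc i))) (ι[k]*[a/d]≡[k*a]/d (suc i) (i !) (suc i)))
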